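{- Let $n\ge1$ and suppose $\underline{a}=a_1\cdots a_n$ is the $m$-th word in the list $G_n$. Then $(n-1)+\sum_{i=1}^n a_i\equiv m \pmod 2$.
   Context: The list $G_n$ of words $a_1\cdots a_n$ (with $1\le a_i\le 2i-1$) is defined recursively: $G_1=(1)$; for $n\ge2$, if $G_{n-1}=(w_1,\ldots,w_N)$, then $G_n$ is the concatenation over $m=1,\ldots,N$ of the blocks $(w_m1,w_m2,\ldots,w_m(2n-1))$ for $m$ odd and $(w_m(2n-1),\ldots,w_m1)$ for $m$ even, where $w_mx$ denotes $w_m$ with the letter $x$ appended. -}

module Defs where

open import Data.Bool using (Bool; true; false; not)
open import Data.Nat using (ℕ; zero; suc; _+_; _*_; _∸_)
open import Data.List using (List; []; _∷_; _++_; map; reverse; upTo; [_])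

-- Words a₁⋯aₙ are lists [a₁, …, aₙ]; "w x" (append letter x) is w ++ [ x ].
appendLetter : List ℕ → ℕ → List ℕ
appendLetter w x = w ++ [ x ]

ascBlock : ℕ → List ℕ → List (List ℕ)
ascBlock k w = map (λ j → appendLetter w (suc j)) (upTo k)

-- Concatenation of blocks over the list (w_m, w_{m+1}, …);
-- the Bool records whether the current index m is odd.
-- Odd m: ascending block (w1, …, wk); even m: descending block (wk, …, w1).
blocks : ℕ → Bool → List (List ℕ) → List (List ℕ)
blocks k _     []       = []
blocks k true  (w ∷ ws) = ascBlock k w ++ blocks k false ws
blocks k false (w ∷ ws) = reverse (ascBlock k w) ++ blocks k true ws

-- Gsuc n = G_{n+1}.  G_1 = (1); G_{n+1} is built from G_n with letters 1..2(n+1)-1.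
Gsuc : ℕ → List (List ℕ)
Gsuc zero    = [ [ 1 ] ]
Gsuc (suc n) = blocks (2 * suc (suc n) ∸ 1) true (Gsuc n)

-- G n = G_n for n ≥ 1 (G 0 = [] is a dummy value, never used).
G : ℕ → List (List ℕ)
G zero    = []
G (suc n) = Gsuc n

module Submission where

-- Write ℙ for the two-element group of parities and let the parity
-- of a word be the parity of its letter sum.  We show that the words of
-- G_n alternate in parity, starting with parity n: the m-th word has
-- parity n + (m - 1).  The theorem is this statement read modulo 2.
--
-- The alternation is an inductive predicate 'Alternating' on lists,
-- stable under concatenation (with the expected shift of the starting
-- parity) and under reversal of lists of odd length.  A block
-- (w1, …, wk) of odd length k alternates starting with the parity
-- opposite to w, and so does its reversal; since every block of G_{n+1}
-- has odd length 2n+1, concatenating the blocks of an alternating list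
-- G_n yields an alternating list whose starting parity is flipped.

open import Defs
open import Data.Nat using (ℕ; suc; _+_; _∸_; _≤_; _%_)
open import Data.Fin using (Fin; toℕ)
open import Data.List using (List; length; lookup)
open import Data.Nat.ListAction using (sum)
open import Relation.Binary.PropositionalEquality using (_≡_)

open import Data.Nat using (zero; _*_; s≤s; parity)
open import Data.Nat.Properties using (*-suc) renaming (+-identityʳ to ℕ-+-identityʳ)
open import Data.Fin using (zero; suc)
open import Data.Bool using (true; false)
open import Data.List using ([]; _∷_; _++_; map; reverse; applyUpTo; [_])
open import Data.List.Properties using (length-map; length-applyUpTo; length-reverse; unfold-reverse)
open import Data.Nat.ListAction.Properties using (sum-++)
open import Data.Parity.Base using (Parity; 0ℙ; 1ℙ; _⁻¹) renaming (_+_ to _⊕_)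
open import Data.Parity.Properties
  using (suc-homo-⁻¹; ⁻¹-involutive; +-homo-+; *-homo-*; p+p≡0ℙ; p+p⁻¹≡1ℙ; +-assoc; +-identityʳ)
open import Relation.Binary.PropositionalEquality using (refl; sym; trans; cong; subst; module ≡-Reasoning)
open ≡-Reasoning

⁻¹-⊕ : ∀ p q → p ⁻¹ ⊕ q ≡ (p ⊕ q) ⁻¹
⁻¹-⊕ 0ℙ q = refl
⁻¹-⊕ 1ℙ q = sym (⁻¹-involutive q)

⊕-⁻¹ : ∀ p q → p ⊕ q ⁻¹ ≡ (p ⊕ q) ⁻¹
⊕-⁻¹ 0ℙ q = refl
⊕-⁻¹ 1ℙ q = refl

parity-suc : ∀ n → parity (suc n) ≡ parity n ⁻¹
parity-suc n = trans (sym (⁻¹-involutive (parity (suc n)))) (cong _⁻¹ (suc-homo-⁻¹ n))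

⊕-1ℙ : ∀ p → p ⊕ 1ℙ ≡ p ⁻¹
⊕-1ℙ 0ℙ = refl
⊕-1ℙ 1ℙ = refl

shift : ∀ p n → p ⊕ parity (suc n) ≡ p ⁻¹ ⊕ parity n
shift p n = begin
  p ⊕ parity (suc n)   ≡⟨ cong (p ⊕_) (parity-suc n) ⟩
  p ⊕ parity n ⁻¹      ≡⟨ ⊕-⁻¹ p (parity n) ⟩
  (p ⊕ parity n) ⁻¹    ≡⟨ sym (⁻¹-⊕ p (parity n)) ⟩
  p ⁻¹ ⊕ parity n      ∎

bit : Parity → ℕ
bit 0ℙ = 0
bit 1ℙ = 1

%2≡bit-parity : ∀ n → n % 2 ≡ bit (parity n)
%2≡bit-parity zero          = refl
%2≡bit-parity (suc zero)    = refl
%2≡bit-parity (suc (suc n)) = %2≡bit-parity n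

parity⇒%2 : ∀ m n → parity m ≡ parity n → m % 2 ≡ n % 2
parity⇒%2 m n eq = trans (%2≡bit-parity m) (trans (cong bit eq) (sym (%2≡bit-parity n)))

-- 2m + 1 is odd; the block lengths 2n - 1 (n ≥ 1) are of this form.
parity-odd : ∀ m → parity (2 * suc m ∸ 1) ≡ 1ℙ
parity-odd m = begin
  parity (2 * suc m ∸ 1)   ≡⟨ cong (λ x → parity (x ∸ 1)) (*-suc 2 m) ⟩
  parity (suc (2 * m))     ≡⟨ parity-suc (2 * m) ⟩
  parity (2 * m) ⁻¹        ≡⟨ cong _⁻¹ (*-homo-* 2 m) ⟩
  1ℙ                       ∎

data Alternating {A : Set} (weight : A → Parity) : Parity → List A → Set where
  []  : ∀ {p} → Alternating weight p []
  _∷_ : ∀ {p x xs} → weight x ≡ p → Alternating weight (p ⁻¹) xs → Alternating weight p (x ∷ xs)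

module _ {A : Set} {weight : A → Parity} where

  alternating-lookup : ∀ {p xs} → Alternating weight p xs → (i : Fin (length xs)) →
                       weight (lookup xs i) ≡ p ⊕ parity (toℕ i)
  alternating-lookup {p} (e ∷ _)  zero    = trans e (sym (+-identityʳ p))
  alternating-lookup {p} (_ ∷ as) (suc i) = trans (alternating-lookup as i) (sym (shift p (toℕ i)))

  alternating-applyUpTo : ∀ {p} (f : ℕ → A) n → (∀ i → weight (f i) ≡ p ⊕ parity i) →
                          Alternating weight p (applyUpTo f n)
  alternating-applyUpTo         f zero    _ = []
  alternating-applyUpTo {p = p} f (suc n) w =
    trans (w 0) (+-identityʳ p) ∷
    alternating-applyUpTo (λ i → f (suc i)) n (λ i → trans (w (suc i)) (shift p i))

  alternating-++ : ∀ {p xs ys} → Alternating weight p xs →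
                   Alternating weight (p ⊕ parity (length xs)) ys →
                   Alternating weight p (xs ++ ys)
  alternating-++ {p} []                 bs = subst (λ q → Alternating weight q _) (+-identityʳ p) bs
  alternating-++ {p} {_ ∷ xs} (e ∷ as) bs =
    e ∷ alternating-++ as (subst (λ q → Alternating weight q _) (shift p (length xs)) bs)

  -- The reversal of xs starts with the weight of the last entry of xs.
  alternating-reverse : ∀ {p xs} → Alternating weight p xs →
                        Alternating weight (p ⊕ parity (suc (length xs))) (reverse xs)
  alternating-reverse []                           = []
  alternating-reverse {p} {x ∷ xs} (e ∷ as) =
    subst (Alternating weight _) (sym (unfold-reverse x xs))
      (alternating-++ reversed (last ∷ []))
    where
    n = length xs
    reversed : Alternating weight (p ⊕ parity n) (reverse xs)
    reversed = subst (λ q → Alternating weight q _)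
                     (trans (shift (p ⁻¹) n) (cong (_⊕ parity n) (⁻¹-involutive p)))
                     (alternating-reverse as)
    last : weight x ≡ (p ⊕ parity n) ⊕ parity (length (reverse xs))
    last = begin
      weight x                                     ≡⟨ e ⟩
      p                                            ≡⟨ sym (+-identityʳ p) ⟩
      p ⊕ 0ℙ                                       ≡⟨ cong (p ⊕_) (sym (p+p≡0ℙ (parity n))) ⟩
      p ⊕ (parity n ⊕ parity n)                    ≡⟨ sym (+-assoc p (parity n) (parity n)) ⟩
      (p ⊕ parity n) ⊕ parity n                    ≡⟨ cong (λ m → (p ⊕ parity n) ⊕ parity m) (sym (length-reverse xs)) ⟩
      (p ⊕ parity n) ⊕ parity (length (reverse xs)) ∎

  alternating-reverse-odd : ∀ {p xs} → parity (length xs) ≡ 1ℙ → Alternating weight p xs →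
                            Alternating weight p (reverse xs)
  alternating-reverse-odd {p} {xs} odd as = subst (λ q → Alternating weight q _) start (alternating-reverse as)
    where
    start : p ⊕ parity (suc (length xs)) ≡ p
    start = begin
      p ⊕ parity (suc (length xs))  ≡⟨ cong (p ⊕_) (parity-suc (length xs)) ⟩
      p ⊕ parity (length xs) ⁻¹     ≡⟨ cong (λ q → p ⊕ q ⁻¹) odd ⟩
      p ⊕ 0ℙ                        ≡⟨ +-identityʳ p ⟩
      p                             ∎

  alternating-++-odd : ∀ {p xs ys} → parity (length xs) ≡ 1ℙ → Alternating weight p xs →
                       Alternating weight (p ⁻¹) ys → Alternating weight p (xs ++ ys)
  alternating-++-odd {p} odd as bs =
    alternating-++ as (subst (λ q → Alternating weight q _) (sym (trans (cong (p ⊕_) odd) (⊕-1ℙ p))) bs)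

  alternating-map : ∀ {B : Set} {p} (f : B → A) {xs} →
                    Alternating (λ x → weight (f x)) p xs → Alternating weight p (map f xs)
  alternating-map f []       = []
  alternating-map f (e ∷ as) = e ∷ alternating-map f as

wordParity : List ℕ → Parity
wordParity w = parity (sum w)

wordParity-append : ∀ w x → wordParity (appendLetter w x) ≡ wordParity w ⊕ parity x
wordParity-append w x = begin
  parity (sum (w ++ [ x ]))      ≡⟨ cong parity (sum-++ w [ x ]) ⟩
  parity (sum w + (x + 0))       ≡⟨ +-homo-+ (sum w) (x + 0) ⟩
  wordParity w ⊕ parity (x + 0)  ≡⟨ cong (λ y → wordParity w ⊕ parity y) (ℕ-+-identityʳ x) ⟩
  wordParity w ⊕ parity x        ∎

ascBlock-alternating : ∀ k w → Alternating wordParity (wordParity w ⁻¹) (ascBlock k w)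
ascBlock-alternating k w = alternating-map (λ j → appendLetter w (suc j))
  (alternating-applyUpTo (λ j → j) k λ j → trans (wordParity-append w (suc j)) (shift (wordParity w) j))

odd-length-ascBlock : ∀ k w → parity k ≡ 1ℙ → parity (length (ascBlock k w)) ≡ 1ℙ
odd-length-ascBlock k w odd =
  trans (cong parity (trans (length-map _ (applyUpTo (λ j → j) k)) (length-applyUpTo (λ j → j) k))) odd

blocks-alternating : ∀ {k p L} → parity k ≡ 1ℙ → ∀ ascending → Alternating wordParity p L →
                     Alternating wordParity (p ⁻¹) (blocks k ascending L)
blocks-alternating odd _     []                = []
blocks-alternating {k} odd true  (_∷_ {x = w} refl as) =
  alternating-++-odd (odd-length-ascBlock k w odd) (ascBlock-alternating k w) (blocks-alternating odd false as)
blocks-alternating {k} odd false (_∷_ {x = w} refl as) =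
  alternating-++-odd (trans (cong parity (length-reverse (ascBlock k w))) (odd-length-ascBlock k w odd))
    (alternating-reverse-odd (odd-length-ascBlock k w odd) (ascBlock-alternating k w))
    (blocks-alternating odd true as)

G-alternating : ∀ n → Alternating wordParity (parity (suc n)) (Gsuc n)
G-alternating zero    = refl ∷ []
G-alternating (suc n) =
  subst (λ q → Alternating wordParity q (Gsuc (suc n))) (suc-homo-⁻¹ n)
    (blocks-alternating {k = 2 * suc (suc n) ∸ 1} (parity-odd (suc n)) true (G-alternating n))

lemma5p2 : (n : ℕ) → 1 ≤ n → (i : Fin (length (G n))) →
    ((n ∸ 1) + sum (lookup (G n) i)) % 2 ≡ suc (toℕ i) % 2
lemma5p2 (suc n) (s≤s _) i = parity⇒%2 (n + sum (lookup (Gsuc n) i)) (suc (toℕ i)) (begin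
  parity (n + sum (lookup (Gsuc n) i))             ≡⟨ +-homo-+ n _ ⟩
  parity n ⊕ wordParity (lookup (Gsuc n) i)        ≡⟨ cong (parity n ⊕_) (alternating-lookup (G-alternating n) i) ⟩
  parity n ⊕ (parity (suc n) ⊕ parity (toℕ i))     ≡⟨ sym (+-assoc (parity n) _ _) ⟩
  (parity n ⊕ parity (suc n)) ⊕ parity (toℕ i)     ≡⟨ cong (λ q → (parity n ⊕ q) ⊕ parity (toℕ i)) (parity-suc n) ⟩
  (parity n ⊕ parity n ⁻¹) ⊕ parity (toℕ i)        ≡⟨ cong (_⊕ parity (toℕ i)) (p+p⁻¹≡1ℙ (parity n)) ⟩
  parity (toℕ i) ⁻¹                               ≡⟨ sym (parity-suc (toℕ i)) ⟩
  parity (suc (toℕ i))                            ∎)
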